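{- Let $c\geq 4$ be an integer and let $T$ be a tree of order $n\geq 3$ with $\delta'(T)\geq c$. Then $L_{2,t}(T)\leq \frac{c-2}{c-1}\,n-c+4$.
   Context: For a tree $T$ of order at least $3$, $\delta'(T)$ denotes the minimum degree of $T$ taken over all non-leaf vertices. $N(v)$ denotes the open neighborhood of $v$. A set $B\subseteq V(T)$ is a $2$-total limited packing set if $|B\cap N(v)|\leq 2$ for every $v\in V(T)$; $L_{2,t}(T)$ is the maximum cardinality of such a set. -}

module Defs where

open import Data.Nat using (ℕ; suc; _≤_; _+_; _*_; _∸_)
open import Data.Bool using (Bool; true; false)
open import Data.Fin using (Fin)
open import Data.Fin.Subset using (Subset; ∣_∣; _∩_; _∈_)
open import Data.Vec using (tabulate)
open import Data.List using (List; []; _∷_; length)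
open import Data.List.Relation.Unary.Unique.Propositional using (Unique)
open import Data.Product using (_×_; Σ; ∃; ∃-syntax)
open import Relation.Binary.PropositionalEquality using (_≡_; _≢_)
open import Relation.Nullary using (¬_)

record Graph (n : ℕ) : Set where
  field
    adj   : Fin n → Fin n → Bool
    sym   : ∀ u v → adj u v ≡ adj v u
    irrefl : ∀ v → adj v v ≡ false
open Graph public

Adj : ∀ {n} → Graph n → Fin n → Fin n → Set
Adj G u v = adj G u v ≡ true

N : ∀ {n} → Graph n → Fin n → Subset n
N G v = tabulate (adj G v)

deg : ∀ {n} → Graph n → Fin n → ℕ
deg G v = ∣ N G v ∣

data Walk {n} (G : Graph n) : Fin n → Fin n → Set where
  here : ∀ v → Walk G v v
  step : ∀ {u v w} → Adj G u v → Walk G v w → Walk G u w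

Connected : ∀ {n} → Graph n → Set
Connected G = ∀ u v → Walk G u v

PathAdj : ∀ {n} → Graph n → List (Fin n) → Set
PathAdj G [] = Data.Unit.⊤ where import Data.Unit
PathAdj G (x ∷ []) = Data.Unit.⊤ where import Data.Unit
PathAdj G (x ∷ y ∷ xs) = Adj G x y × PathAdj G (y ∷ xs)

IsCycle : ∀ {n} → Graph n → List (Fin n) → Set
IsCycle G [] = Data.Empty.⊥ where import Data.Empty
IsCycle G (v₀ ∷ rest) =
  Unique (v₀ ∷ rest) × 3 ≤ suc (length rest) × PathAdj G (v₀ ∷ rest) × LastAdj v₀ rest
  where
    LastAdj : Fin _ → List (Fin _) → Set
    LastAdj a [] = Adj G a v₀
    LastAdj a (b ∷ bs) = LastAdj b bs

Acyclic : ∀ {n} → Graph n → Set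
Acyclic G = ∀ cyc → ¬ IsCycle G cyc

IsTree : ∀ {n} → Graph n → Set
IsTree G = Connected G × Acyclic G

MinNonLeafDegAtLeast : ∀ {n} → Graph n → ℕ → Set
MinNonLeafDegAtLeast G c = ∀ v → deg G v ≢ 1 → c ≤ deg G v

IsTwoTotalLimitedPacking : ∀ {n} → Graph n → Subset n → Set
IsTwoTotalLimitedPacking G B = ∀ v → ∣ B ∩ N G v ∣ ≤ 2

-- Let s be the number of internal vertices (degree ≠ 1). In a forest every
-- nonempty induced subgraph has a vertex of degree ≤ 1 (the end of a maximal
-- path), so removing such vertices one by one bounds the degree sum by 2(n − 1);
-- as leaves have degree 1 and internal vertices degree ≥ c, (c − 1)s + 2 ≤ n.
-- If every vertex has an internal neighbour, each vertex of B is among the at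
-- most two B-neighbours of an internal vertex, so |B| ≤ 2s. Otherwise some
-- vertex has only leaf neighbours; by connectivity the tree is a star around it
-- and |B| ≤ 3. Since n ≥ 3 forces s ≥ 1, in both cases |B| ≤ 2s + 1, and the
-- bound is arithmetic from there.
module Submission where

open import Data.Bool using (Bool; true; false; not; _∧_; if_then_else_)
open import Data.Fin using (Fin; zero; suc; fromℕ<)
import Data.Fin.Properties as Fin
open import Data.Fin.Subset using (Subset; ∣_∣; _∩_)
open import Data.List as List using (List; []; _∷_; _++_; [_]; length)
open import Data.List.Membership.Propositional using (_∉_)
open import Data.List.Membership.Propositional.Properties using (∈-lookup; ∈-∃++)
open import Data.List.Properties using (length-++; ++-assoc)
open import Data.List.Relation.Unary.All as All using (All; []; _∷_)
open import Data.List.Relation.Unary.All.Properties using (¬Any⇒All¬; ++⁻ˡ)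
open import Data.List.Relation.Unary.AllPairs using ([]; _∷_)
open import Data.List.Relation.Unary.Any using (here; there)
open import Data.List.Relation.Unary.Unique.Propositional using (Unique)
open import Data.Nat using (ℕ; zero; suc; pred; _+_; _*_; _∸_; _≤_; _<_; z≤n; s≤s; s≤s⁻¹)
open import Data.Nat.Properties
open import Data.Nat.Tactic.RingSolver using (solve-∀)
open import Data.Product using (∃; _×_; _,_)
import Data.Product as Product
open import Data.Sum using (_⊎_; inj₁; inj₂)
open import Data.Unit using (tt)
open import Data.Vec using ([]; _∷_; lookup)
open import Data.Vec.Properties using (lookup-zipWith; lookup∘tabulate)
open import Function using (id)
open import Function.Definitions using (Injective)
open import Relation.Binary.PropositionalEquality
  using (_≡_; _≢_; refl; sym; trans; cong; cong₂; subst; subst₂; module ≡-Reasoning)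
open import Relation.Nullary using (Dec; does; yes; no; contradiction)

open import Algebra.Properties.CommutativeSemigroup +-commutativeSemigroup using (x∙yz≈y∙xz)
open import Algebra.Properties.Semiring.Sum +-*-semiring
  using (sum; sum-syntax; sum-cong-≗; sum-replicate-zero; ∑-comm; ∑-distrib-+; *-distribˡ-sum)
open import Defs renaming (sym to adj-sym)

𝟙 : Bool → ℕ
𝟙 b = if b then 1 else 0

𝟙≤1 : ∀ b → 𝟙 b ≤ 1
𝟙≤1 true = ≤-refl
𝟙≤1 false = z≤n

𝟙-pos : ∀ {b} → 0 < 𝟙 b → b ≡ true
𝟙-pos {true} _ = refl

-- Sums over vertex sets

-- Vertex sets are Boolean predicates on Fin n; a Subset p is read as lookup p.
module _ {n : ℕ} where

  ∑∈ : (Fin n → Bool) → (Fin n → ℕ) → ℕ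
  ∑∈ X f = ∑[ i < n ] (if X i then f i else 0)

  syntax ∑∈ X (λ i → e) = ∑[ i ∈ X ] e

  card : (Fin n → Bool) → ℕ
  card X = ∑[ i ∈ X ] 1

  _∖_ : (Fin n → Bool) → Fin n → Fin n → Bool
  (X ∖ x) i = not (does (i Fin.≟ x)) ∧ X i

  ∖-member : ∀ {X x i} → (X ∖ x) i ≡ true → X i ≡ true × i ≢ x
  ∖-member {x = x} {i} i∈X∖x with i Fin.≟ x
  ... | no i≢x = i∈X∖x , i≢x

  ∖-intro : ∀ {X x i} → X i ≡ true → i ≢ x → (X ∖ x) i ≡ true
  ∖-intro {x = x} {i} i∈X i≢x with i Fin.≟ x
  ... | yes i≡x = contradiction i≡x i≢x
  ... | no _ = i∈X

∑1≡n : ∀ n → ∑[ i < n ] 1 ≡ n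
∑1≡n zero = refl
∑1≡n (suc n) = cong suc (∑1≡n n)

sum-mono-≤ : ∀ {n} {f g : Fin n → ℕ} → (∀ i → f i ≤ g i) → sum f ≤ sum g
sum-mono-≤ {zero} f≤g = z≤n
sum-mono-≤ {suc n} f≤g = +-mono-≤ (f≤g zero) (sum-mono-≤ (λ i → f≤g (suc i)))

∑∈-split : ∀ {n} (X : Fin n → Bool) (f : Fin n → ℕ) x →
           ∑[ i ∈ X ] f i ≡ (if X x then f x else 0) + ∑[ i ∈ X ∖ x ] f i
∑∈-split X f zero = refl
∑∈-split X f (suc x) =
  trans (cong (head +_) (∑∈-split (λ i → X (suc i)) (λ i → f (suc i)) x))
        (x∙yz≈y∙xz head (if X (suc x) then f (suc x) else 0) _)
  where
  head : ℕ
  head = if X zero then f zero else 0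

module _ {n : ℕ} (X : Fin n → Bool) where

  ∑∈-cong : {f g : Fin n → ℕ} → (∀ i → f i ≡ g i) → ∑[ i ∈ X ] f i ≡ ∑[ i ∈ X ] g i
  ∑∈-cong f≗g = sum-cong-≗ (λ i → cong (λ k → if X i then k else 0) (f≗g i))

  ∑∈-mono-≤ : {f g : Fin n → ℕ} → (∀ i → X i ≡ true → f i ≤ g i) →
              ∑[ i ∈ X ] f i ≤ ∑[ i ∈ X ] g i
  ∑∈-mono-≤ {f} {g} f≤g = sum-mono-≤ pointwise
    where
    pointwise : ∀ i → (if X i then f i else 0) ≤ (if X i then g i else 0)
    pointwise i with X i in i∈X
    ... | true = f≤g i i∈X
    ... | false = z≤n

  ∑∈-distrib-+ : (f g : Fin n → ℕ) → ∑[ i ∈ X ] (f i + g i) ≡ ∑[ i ∈ X ] f i + ∑[ i ∈ X ] g i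
  ∑∈-distrib-+ f g =
    trans (sum-cong-≗ pointwise)
          (∑-distrib-+ (λ i → if X i then f i else 0) (λ i → if X i then g i else 0))
    where
    pointwise : ∀ i → (if X i then f i + g i else 0)
                    ≡ (if X i then f i else 0) + (if X i then g i else 0)
    pointwise i with X i
    ... | true = refl
    ... | false = refl

  ∑∈-const : ∀ k → ∑[ i ∈ X ] k ≡ k * card X
  ∑∈-const k = trans (sum-cong-≗ pointwise) (sym (*-distribˡ-sum k (λ i → 𝟙 (X i))))
    where
    pointwise : ∀ i → (if X i then k else 0) ≡ k * 𝟙 (X i)
    pointwise i with X i
    ... | true = sym (*-identityʳ k)
    ... | false = sym (*-zeroʳ k)

  ∑∈-remove : (f : Fin n → ℕ) → ∀ {x} → X x ≡ true →
              ∑[ i ∈ X ] f i ≡ f x + ∑[ i ∈ X ∖ x ] f i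
  ∑∈-remove f {x} x∈X rewrite ∑∈-split X f x | x∈X = refl

  ∑∈-term : (f : Fin n → ℕ) → ∀ {x} → X x ≡ true → f x ≤ ∑[ i ∈ X ] f i
  ∑∈-term f {x} x∈X rewrite ∑∈-remove f x∈X = m≤m+n (f x) _

  card≡0⇒∉ : card X ≡ 0 → ∀ i → X i ≡ false
  card≡0⇒∉ empty i with X i in i∈X
  ... | false = refl
  ... | true = contradiction (subst (1 ≤_) empty (∑∈-term (λ _ → 1) i∈X)) λ ()

∑∈-pos : ∀ {n} (X : Fin n → Bool) (f : Fin n → ℕ) →
         0 < ∑[ i ∈ X ] f i → ∃ λ i → X i ≡ true × 0 < f i
∑∈-pos {suc n} X f pos with X zero in 0∈X | f zero in f₀
... | true | suc _ = zero , 0∈X , subst (0 <_) (sym f₀) (s≤s z≤n)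
... | true | zero = Product.map suc id (∑∈-pos (λ i → X (suc i)) (λ i → f (suc i)) pos)
... | false | _ = Product.map suc id (∑∈-pos (λ i → X (suc i)) (λ i → f (suc i)) pos)

∑∈-empty : ∀ {n} (X : Fin n → Bool) (f : Fin n → ℕ) → card X ≡ 0 → ∑[ i ∈ X ] f i ≡ 0
∑∈-empty {zero} X f _ = refl
∑∈-empty {suc n} X f empty with X zero
∑∈-empty {suc n} X f () | true
∑∈-empty {suc n} X f empty | false = ∑∈-empty (λ i → X (suc i)) (λ i → f (suc i)) empty

∑∈-comm : ∀ {n} (X Y : Fin n → Bool) (f : Fin n → Fin n → ℕ) →
          ∑[ i ∈ X ] ∑[ j ∈ Y ] f i j ≡ ∑[ j ∈ Y ] ∑[ i ∈ X ] f i j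
∑∈-comm {n} X Y f = begin
  ∑[ i ∈ X ] ∑[ j ∈ Y ] f i j
    ≡⟨ sum-cong-≗ (λ i → if-sum (X i)) ⟩
  ∑[ i < n ] ∑[ j < n ] f′ i j
    ≡⟨ ∑-comm f′ ⟩
  ∑[ j < n ] ∑[ i < n ] f′ i j
    ≡⟨ sum-cong-≗ (λ j → trans (sum-cong-≗ (λ i → if-swap (X i) (Y j))) (sym (if-sum (Y j)))) ⟩
  ∑[ j ∈ Y ] ∑[ i ∈ X ] f i j ∎
  where
  open ≡-Reasoning
  f′ : Fin n → Fin n → ℕ
  f′ i j = if X i then (if Y j then f i j else 0) else 0
  if-sum : ∀ b {g : Fin n → ℕ} → (if b then sum g else 0) ≡ ∑[ i < n ] (if b then g i else 0)
  if-sum true = refl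
  if-sum false = sym (sum-replicate-zero n)
  if-swap : ∀ a b {k} → (if a then (if b then k else 0) else 0)
                      ≡ (if b then (if a then k else 0) else 0)
  if-swap true b = refl
  if-swap false true = refl
  if-swap false false = refl

∣p∣≡card : ∀ {n} (p : Subset n) → ∣ p ∣ ≡ card (lookup p)
∣p∣≡card [] = refl
∣p∣≡card (true ∷ p) = cong suc (∣p∣≡card p)
∣p∣≡card (false ∷ p) = ∣p∣≡card p

unique-++⁻ˡ : ∀ {A : Set} (xs : List A) {ys} → Unique (xs ++ ys) → Unique xs
unique-++⁻ˡ [] _ = []
unique-++⁻ˡ (x ∷ xs) (x∉ ∷ u) = ++⁻ˡ xs x∉ ∷ unique-++⁻ˡ xs u

lookup-injective : ∀ {A : Set} {xs : List A} → Unique xs → Injective _≡_ _≡_ (List.lookup xs)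
lookup-injective (_ ∷ _) {zero} {zero} _ = refl
lookup-injective (x∉ ∷ _) {zero} {suc j} eq = contradiction eq (All.lookup x∉ (∈-lookup j))
lookup-injective (x∉ ∷ _) {suc i} {zero} eq = contradiction (sym eq) (All.lookup x∉ (∈-lookup i))
lookup-injective (_ ∷ u) {suc i} {suc j} eq = cong suc (lookup-injective u eq)

length-unique≤ : ∀ {n} {xs : List (Fin n)} → Unique xs → length xs ≤ n
length-unique≤ u = Fin.injective⇒≤ (lookup-injective u)

-- Forests

-- IsCycle states its closing edge through a function local to its definition;
-- unifying the cycle type with a product is how that component gets a name.
LastComponent : {A B C D : Set} (S : Set) → S ≡ (A × B × C × D) → Set
LastComponent {D = D} _ _ = D

module _ {n : ℕ} (G : Graph n) where

  adj⇒≢ : ∀ {u v} → Adj G u v → v ≢ u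
  adj⇒≢ {u} u~u refl with () ← trans (sym u~u) (irrefl G u)

  deg≡card : ∀ v → deg G v ≡ card (adj G v)
  deg≡card v = trans (∣p∣≡card (N G v)) (sum-cong-≗ (λ w → cong 𝟙 (lookup∘tabulate (adj G v) w)))

  degIn : (Fin n → Bool) → Fin n → ℕ
  degIn X u = ∑[ w ∈ X ] 𝟙 (adj G u w)

  ∣∩N∣≡degIn : ∀ (B : Subset n) v → ∣ B ∩ N G v ∣ ≡ degIn (lookup B) v
  ∣∩N∣≡degIn B v = trans (∣p∣≡card (B ∩ N G v)) (sum-cong-≗ pointwise)
    where
    pointwise : ∀ w → 𝟙 (lookup (B ∩ N G v) w) ≡ (if lookup B w then 𝟙 (adj G v w) else 0)
    pointwise w rewrite lookup-zipWith _∧_ w B (N G v) | lookup∘tabulate (adj G v) w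
      with lookup B w
    ... | true = refl
    ... | false = refl

  pathAdj-++⁻ˡ : ∀ xs {ys} → PathAdj G (xs ++ ys) → PathAdj G xs
  pathAdj-++⁻ˡ [] _ = tt
  pathAdj-++⁻ˡ (x ∷ []) _ = tt
  pathAdj-++⁻ˡ (x ∷ y ∷ xs) (x~y , path) = x~y , pathAdj-++⁻ˡ (y ∷ xs) path

  ClosingEdge : Fin n → Fin n → List (Fin n) → Set
  ClosingEdge v₀ x xs = LastComponent (IsCycle G (v₀ ∷ x ∷ xs)) refl

  closingEdge : ∀ {v₀ y} x ys → Adj G y v₀ → ClosingEdge v₀ x (ys ++ [ y ])
  closingEdge x [] y~v₀ = y~v₀
  closingEdge x (z ∷ ys) y~v₀ = closingEdge z ys y~v₀

  no-chord : Acyclic G → ∀ {h p y} t → Unique (h ∷ p ∷ t) → PathAdj G (h ∷ p ∷ t) →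
             Adj G h y → y ∉ t
  no-chord acyclic {h} {p} {y} t distinct path h~y y∈t with ys , zs , refl ← ∈-∃++ y∈t =
    acyclic (h ∷ p ∷ ys ++ [ y ])
      ( unique-++⁻ˡ (h ∷ p ∷ ys ++ [ y ]) (subst Unique split distinct)
      , s≤s (s≤s (subst (1 ≤_) (sym (length-++ ys)) (m≤n+m 1 (length ys))))
      , pathAdj-++⁻ˡ (h ∷ p ∷ ys ++ [ y ]) (subst (PathAdj G) split path)
      , closingEdge p ys (trans (adj-sym G y h) h~y))
    where
    split : h ∷ p ∷ ys ++ y ∷ zs ≡ (h ∷ p ∷ ys ++ [ y ]) ++ zs
    split = cong (λ l → h ∷ p ∷ l) (sym (++-assoc ys [ y ] zs))

  degIn-split : ∀ X x u → degIn X u ≡ (if X x then 𝟙 (adj G u x) else 0) + degIn (X ∖ x) u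
  degIn-split X x u = ∑∈-split X (λ w → 𝟙 (adj G u w)) x

  degIn-self : ∀ X x → degIn X x ≡ degIn (X ∖ x) x
  degIn-self X x rewrite degIn-split X x x | irrefl G x with X x
  ... | true = refl
  ... | false = refl

  degIn≤card : ∀ X x → degIn X x ≤ card (X ∖ x)
  degIn≤card X x = subst (_≤ card (X ∖ x)) (sym (degIn-self X x))
    (∑∈-mono-≤ (X ∖ x) (λ w _ → 𝟙≤1 (adj G x w)))

  degSumIn : (Fin n → Bool) → ℕ
  degSumIn X = ∑[ u ∈ X ] degIn X u

  degSumIn-remove : ∀ X {x} → X x ≡ true →
                    degSumIn X ≡ degIn X x + (degIn X x + degSumIn (X ∖ x))
  degSumIn-remove X {x} x∈X = begin
    degSumIn X
      ≡⟨ ∑∈-remove X (degIn X) x∈X ⟩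
    degIn X x + ∑[ u ∈ X ∖ x ] degIn X u
      ≡⟨ cong (degIn X x +_) (∑∈-cong (X ∖ x) λ u → ∑∈-remove X (λ w → 𝟙 (adj G u w)) x∈X) ⟩
    degIn X x + ∑[ u ∈ X ∖ x ] (𝟙 (adj G u x) + degIn (X ∖ x) u)
      ≡⟨ cong (degIn X x +_) (∑∈-distrib-+ (X ∖ x) _ (degIn (X ∖ x))) ⟩
    degIn X x + (∑[ u ∈ X ∖ x ] 𝟙 (adj G u x) + degSumIn (X ∖ x))
      ≡⟨ cong (λ d → degIn X x + (d + degSumIn (X ∖ x))) edges-at-x ⟩
    degIn X x + (degIn X x + degSumIn (X ∖ x)) ∎
    where
    open ≡-Reasoning
    edges-at-x : ∑[ u ∈ X ∖ x ] 𝟙 (adj G u x) ≡ degIn X x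
    edges-at-x = trans (∑∈-cong (X ∖ x) λ u → cong 𝟙 (adj-sym G u x)) (sym (degIn-self X x))

  module _ (acyclic : Acyclic G) (X : Fin n → Bool) where

    record Trail (h : Fin n) (P : List (Fin n)) : Set where
      field
        inside : All (λ v → X v ≡ true) (h ∷ P)
        distinct : Unique (h ∷ P)
        path : PathAdj G (h ∷ P)
    open Trail

    neighbour-besides : ∀ {h} p → 2 ≤ degIn X h → ∃ λ y → X y ≡ true × Adj G h y × y ≢ p
    neighbour-besides {h} p 2≤deg with ∑∈-pos (X ∖ p) (λ w → 𝟙 (adj G h w)) others
      where
      open ≤-Reasoning
      at-p≤1 : ∀ b → (if b then 𝟙 (adj G h p) else 0) ≤ 1
      at-p≤1 true = 𝟙≤1 (adj G h p)
      at-p≤1 false = z≤n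
      others : 1 ≤ degIn (X ∖ p) h
      others = s≤s⁻¹ (begin
        2                                                    ≤⟨ 2≤deg ⟩
        degIn X h                                            ≡⟨ degIn-split X p h ⟩
        (if X p then 𝟙 (adj G h p) else 0) + degIn (X ∖ p) h ≤⟨ +-monoˡ-≤ _ (at-p≤1 (X p)) ⟩
        1 + degIn (X ∖ p) h                                  ∎)
    ... | y , y∈X∖p , h~y with y∈X , y≢p ← ∖-member {X = X} y∈X∖p = y , y∈X , 𝟙-pos h~y , y≢p

    extendable : ∀ {h P} → Trail h P → 2 ≤ degIn X h →
                 ∃ λ y → X y ≡ true × Adj G h y × y ∉ h ∷ P
    extendable {h} {[]} tr 2≤deg with y , y∈X , h~y , y≢h ← neighbour-besides h 2≤deg =
      y , y∈X , h~y , λ { (here y≡h) → y≢h y≡h }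
    extendable {h} {p ∷ t} tr 2≤deg with y , y∈X , h~y , y≢p ← neighbour-besides p 2≤deg =
      y , y∈X , h~y , λ where
        (here y≡h) → adj⇒≢ h~y y≡h
        (there (here y≡p)) → y≢p y≡p
        (there (there y∈t)) → no-chord acyclic t (distinct tr) (path tr) h~y y∈t

    extend : ∀ {h P y} → Trail h P → X y ≡ true → Adj G h y → y ∉ h ∷ P → Trail y (h ∷ P)
    extend {h} {y = y} tr y∈X h~y y∉ = record
      { inside = y∈X ∷ inside tr
      ; distinct = ¬Any⇒All¬ _ y∉ ∷ distinct tr
      ; path = trans (adj-sym G y h) h~y , path tr
      }

    leaf-search : ∀ fuel {h P} → Trail h P → n < length (h ∷ P) + fuel →
                  ∃ λ x → X x ≡ true × degIn X x ≤ 1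
    leaf-search zero tr n<len =
      contradiction (length-unique≤ (distinct tr)) (<⇒≱ (subst (n <_) (+-identityʳ _) n<len))
    leaf-search (suc fuel) {h} tr n<len with degIn X h ≤? 1
    ... | yes deg≤1 = h , All.head (inside tr) , deg≤1
    ... | no deg≰1 with y , y∈X , h~y , y∉ ← extendable tr (≰⇒> deg≰1) =
      leaf-search fuel (extend tr y∈X h~y y∉) (subst (n <_) (+-suc _ fuel) n<len)

    forest-has-leaf : ∀ {x₀} → X x₀ ≡ true → ∃ λ x → X x ≡ true × degIn X x ≤ 1
    forest-has-leaf x₀∈X =
      leaf-search n (record { inside = x₀∈X ∷ [] ; distinct = [] ∷ [] ; path = tt }) ≤-refl

  degSumIn-acyclic : Acyclic G → ∀ k X → card X ≡ k → degSumIn X ≤ 2 * pred k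
  degSumIn-acyclic acyclic zero X empty = ≤-reflexive (∑∈-empty X (degIn X) empty)
  degSumIn-acyclic acyclic (suc k) X size
    with x₀ , x₀∈X , _ ← ∑∈-pos X (λ _ → 1) (subst (0 <_) (sym size) (s≤s z≤n))
    with x , x∈X , deg≤1 ← forest-has-leaf acyclic X x₀∈X = begin
      degSumIn X                                  ≡⟨ degSumIn-remove X x∈X ⟩
      degIn X x + (degIn X x + degSumIn (X ∖ x))  ≤⟨ leaf-removal k deg≤1 deg≤k IH ⟩
      2 * k                                       ∎
    where
    open ≤-Reasoning
    leaf-removal : ∀ {d e} k → d ≤ 1 → d ≤ k → e ≤ 2 * pred k → d + (d + e) ≤ 2 * k
    leaf-removal zero _ z≤n e≤0 = e≤0
    leaf-removal (suc k) d≤1 _ e≤ =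
      ≤-trans (+-mono-≤ d≤1 (+-mono-≤ d≤1 e≤)) (≤-reflexive (sym (*-suc 2 k)))
    size′ : card (X ∖ x) ≡ k
    size′ = suc-injective (trans (sym (∑∈-remove X (λ _ → 1) x∈X)) size)
    deg≤k : degIn X x ≤ k
    deg≤k = subst (degIn X x ≤_) size′ (degIn≤card X x)
    IH : degSumIn (X ∖ x) ≤ 2 * pred k
    IH = degSumIn-acyclic acyclic k (X ∖ x) size′

  ∑deg-acyclic : Acyclic G → ∑[ v < n ] deg G v ≤ 2 * pred n
  ∑deg-acyclic acyclic = begin
    ∑[ v < n ] deg G v      ≡⟨ sum-cong-≗ deg≡card ⟩
    degSumIn (λ _ → true)   ≤⟨ degSumIn-acyclic acyclic n (λ _ → true) (∑1≡n n) ⟩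
    2 * pred n              ∎
    where open ≤-Reasoning

  -- Internal vertices

  -- As in MinNonLeafDegAtLeast, isolated vertices count as internal.
  internal : Fin n → Bool
  internal v = not (does (deg G v ≟ 1))

  internal-false : ∀ {v} → internal v ≡ false → deg G v ≡ 1
  internal-false {v} = leaf (deg G v ≟ 1)
    where
    leaf : ∀ {d} (d≟1 : Dec (d ≡ 1)) → not (does d≟1) ≡ false → d ≡ 1
    leaf (yes d≡1) _ = d≡1

  internal-true : ∀ {v} → internal v ≡ true → deg G v ≢ 1
  internal-true {v} = non-leaf (deg G v ≟ 1)
    where
    non-leaf : ∀ {d} (d≟1 : Dec (d ≡ 1)) → not (does d≟1) ≡ true → d ≢ 1
    non-leaf (no d≢1) _ = d≢1

  deg-lower-bound : ∀ {c} → 1 ≤ c → MinNonLeafDegAtLeast G c →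
                    ∀ v → 1 + (c ∸ 1) * 𝟙 (internal v) ≤ deg G v
  deg-lower-bound {c} 1≤c δ′≥c v with internal v in v-int
  ... | false = ≤-reflexive (trans (cong suc (*-zeroʳ (c ∸ 1))) (sym (internal-false v-int)))
  ... | true = subst (_≤ deg G v) c≡ (δ′≥c v (internal-true v-int))
    where
    c≡ : c ≡ 1 + (c ∸ 1) * 1
    c≡ = trans (sym (m+[n∸m]≡n 1≤c)) (cong suc (sym (*-identityʳ (c ∸ 1))))

  card-internal-bound : ∀ {c} → Acyclic G → 1 ≤ c → MinNonLeafDegAtLeast G c → 1 ≤ n →
                        (c ∸ 1) * card internal + 2 ≤ n
  card-internal-bound {c} acyclic 1≤c δ′≥c 1≤n = handshake 1≤n (begin
    n + (c ∸ 1) * card internal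
      ≡⟨ cong₂ _+_ (sym (∑1≡n n)) (*-distribˡ-sum (c ∸ 1) (λ v → 𝟙 (internal v))) ⟩
    ∑[ v < n ] 1 + ∑[ v < n ] ((c ∸ 1) * 𝟙 (internal v))
      ≡⟨ ∑-distrib-+ (λ _ → 1) (λ v → (c ∸ 1) * 𝟙 (internal v)) ⟨
    ∑[ v < n ] (1 + (c ∸ 1) * 𝟙 (internal v))
      ≤⟨ sum-mono-≤ (deg-lower-bound 1≤c δ′≥c) ⟩
    ∑[ v < n ] deg G v
      ≤⟨ ∑deg-acyclic acyclic ⟩
    2 * pred n ∎)
    where
    open ≤-Reasoning
    handshake : ∀ {m x} → 1 ≤ m → m + x ≤ 2 * pred m → x + 2 ≤ m
    handshake {suc m} {x} _ le = subst (_≤ suc m) (+-comm 2 x) (s≤s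
      (+-cancelˡ-≤ m (suc x) m (subst₂ _≤_ (sym (+-suc m x)) (cong (m +_) (+-identityʳ m)) le)))

  leaf-neighbour-unique : ∀ {u a b} → deg G u ≡ 1 → Adj G u a → Adj G u b → a ≡ b
  leaf-neighbour-unique {u} {a} {b} deg≡1 u~a u~b with b Fin.≟ a
  ... | yes b≡a = sym b≡a
  ... | no b≢a = contradiction (begin
    2                         ≤⟨ s≤s (∑∈-term (adj G u ∖ a) (λ _ → 1) (∖-intro {X = adj G u} u~b b≢a)) ⟩
    1 + card (adj G u ∖ a)    ≡⟨ ∑∈-remove (adj G u) (λ _ → 1) u~a ⟨
    card (adj G u)            ≡⟨ deg≡card u ⟨
    deg G u                   ≡⟨ deg≡1 ⟩
    1                         ∎) (<-irrefl refl)
    where open ≤-Reasoning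

  leaf-neighbours⇒dominating : Connected G → ∀ {b} → (∀ v → Adj G b v → deg G v ≡ 1) →
                               ∀ w → w ≡ b ⊎ Adj G b w
  leaf-neighbours⇒dominating connected {b} leaves w = reach (connected b w) (inj₁ refl)
    where
    reach : ∀ {u w} → Walk G u w → u ≡ b ⊎ Adj G b u → w ≡ b ⊎ Adj G b w
    reach (here _) near = near
    reach (step u~v walk) (inj₁ refl) = reach walk (inj₂ u~v)
    reach (step {u} u~v walk) (inj₂ b~u) =
      reach walk (inj₁ (leaf-neighbour-unique (leaves u b~u) u~v (trans (adj-sym G u b) b~u)))

  card≤1+degIn : ∀ {b} → (∀ w → w ≡ b ⊎ Adj G b w) → ∀ Y → card Y ≤ 1 + degIn Y b
  card≤1+degIn {b} dominating Y = begin
    card Y                                ≡⟨ ∑∈-split Y (λ _ → 1) b ⟩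
    (if Y b then 1 else 0) + card (Y ∖ b) ≤⟨ +-mono-≤ (𝟙≤1 (Y b)) (∑∈-mono-≤ (Y ∖ b) neighbour) ⟩
    1 + degIn (Y ∖ b) b                   ≡⟨ cong suc (degIn-self Y b) ⟨
    1 + degIn Y b                         ∎
    where
    open ≤-Reasoning
    neighbour : ∀ w → (Y ∖ b) w ≡ true → 1 ≤ 𝟙 (adj G b w)
    neighbour w w∈Y∖b with dominating w | ∖-member {X = Y} w∈Y∖b
    ... | inj₁ w≡b | _ , w≢b = contradiction w≡b w≢b
    ... | inj₂ b~w | _ = ≤-reflexive (cong 𝟙 (sym b~w))

  card-internal-pos : Connected G → 3 ≤ n → 1 ≤ card internal
  card-internal-pos connected 3≤n = n≢0⇒n>0 λ none → <⇒≱ 3≤n (begin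
    n                         ≡⟨ ∑1≡n n ⟨
    card {n} (λ _ → true)     ≤⟨ card≤1+degIn (dominating none) (λ _ → true) ⟩
    1 + card (adj G b)        ≡⟨ cong suc (trans (sym (deg≡card b)) (leaf none b)) ⟩
    2                         ∎)
    where
    open ≤-Reasoning
    b : Fin n
    b = fromℕ< {0} (≤-trans (s≤s z≤n) 3≤n)
    leaf : card internal ≡ 0 → ∀ v → deg G v ≡ 1
    leaf none v = internal-false (card≡0⇒∉ internal none v)
    dominating : card internal ≡ 0 → ∀ w → w ≡ b ⊎ Adj G b w
    dominating none = leaf-neighbours⇒dominating connected (λ v _ → leaf none v)

  -- Packings

  TotallyDominates : (Fin n → Bool) → Set
  TotallyDominates S = ∀ v → 1 ≤ degIn S v

  packing≤2*dominating : ∀ B {S} → IsTwoTotalLimitedPacking G B → TotallyDominates S →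
                         ∣ B ∣ ≤ 2 * card S
  packing≤2*dominating B {S} packing dominates = begin
    ∣ B ∣                                        ≡⟨ ∣p∣≡card B ⟩
    card (lookup B)                              ≤⟨ ∑∈-mono-≤ (lookup B) (λ b _ → dominates b) ⟩
    ∑[ b ∈ lookup B ] ∑[ v ∈ S ] 𝟙 (adj G b v)   ≡⟨ ∑∈-comm (lookup B) S (λ b v → 𝟙 (adj G b v)) ⟩
    ∑[ v ∈ S ] ∑[ b ∈ lookup B ] 𝟙 (adj G b v)   ≡⟨ ∑∈-cong S (λ v → ∑∈-cong (lookup B) (λ b →
                                                      cong 𝟙 (adj-sym G b v))) ⟩
    ∑[ v ∈ S ] degIn (lookup B) v                ≡⟨ ∑∈-cong S (λ v → ∣∩N∣≡degIn B v) ⟨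
    ∑[ v ∈ S ] ∣ B ∩ N G v ∣                     ≤⟨ ∑∈-mono-≤ S (λ v _ → packing v) ⟩
    ∑[ v ∈ S ] 2                                 ≡⟨ ∑∈-const S 2 ⟩
    2 * card S                                   ∎
    where open ≤-Reasoning

  -- Either the internal vertices totally dominate G, or G is a star.
  packing≤1+2*internal : Connected G → ∀ B → IsTwoTotalLimitedPacking G B →
                         1 ≤ card internal → ∣ B ∣ ≤ 1 + 2 * card internal
  packing≤1+2*internal connected B packing 1≤s with Fin.all? (λ v → 1 ≤? degIn internal v)
  ... | yes dominates = ≤-trans (packing≤2*dominating B packing dominates) (n≤1+n _)
  ... | no ¬dominates
    with b , no-internal ← Fin.¬∀⟶∃¬ n _ (λ v → 1 ≤? degIn internal v) ¬dominates = begin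
      ∣ B ∣                     ≡⟨ ∣p∣≡card B ⟩
      card (lookup B)           ≤⟨ card≤1+degIn dominating (lookup B) ⟩
      1 + degIn (lookup B) b    ≡⟨ cong suc (∣∩N∣≡degIn B b) ⟨
      1 + ∣ B ∩ N G b ∣         ≤⟨ s≤s (packing b) ⟩
      3                         ≤⟨ s≤s (*-monoʳ-≤ 2 1≤s) ⟩
      1 + 2 * card internal     ∎
    where
    open ≤-Reasoning
    leaves : ∀ v → Adj G b v → deg G v ≡ 1
    leaves v b~v with internal v in v-int
    ... | false = internal-false v-int
    ... | true = contradiction
      (≤-trans (≤-reflexive (cong 𝟙 (sym b~v))) (∑∈-term internal (λ v → 𝟙 (adj G b v)) v-int))
      no-internal
    dominating : ∀ w → w ≡ b ⊎ Adj G b w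
    dominating = leaf-neighbours⇒dominating connected leaves

packing-arithmetic : ∀ {c n b s} → 4 ≤ c → 1 ≤ s → b ≤ 1 + 2 * s → (c ∸ 1) * s + 2 ≤ n →
                     (c ∸ 1) * b + (c ∸ 1) * (c ∸ 4) ≤ (c ∸ 2) * n
packing-arithmetic {suc (suc (suc (suc k)))} {n} {b} {suc t}
                   (s≤s (s≤s (s≤s (s≤s z≤n)))) (s≤s z≤n) b≤ n≥ = begin
  (3 + k) * b + (3 + k) * k
    ≤⟨ +-monoˡ-≤ _ (*-monoʳ-≤ (3 + k) b≤) ⟩
  (3 + k) * (1 + 2 * suc t) + (3 + k) * k
    ≤⟨ m≤m+n _ (1 + k + k * (3 + k) * t) ⟩
  (3 + k) * (1 + 2 * suc t) + (3 + k) * k + (1 + k + k * (3 + k) * t)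
    ≡⟨ identity k t ⟩
  (2 + k) * ((3 + k) * suc t + 2)
    ≤⟨ *-monoʳ-≤ (2 + k) n≥ ⟩
  (2 + k) * n ∎
  where
  open ≤-Reasoning
  identity : ∀ k t → (3 + k) * (1 + 2 * suc t) + (3 + k) * k + (1 + k + k * (3 + k) * t)
                     ≡ (2 + k) * ((3 + k) * suc t + 2)
  identity = solve-∀

mainTheorem5 : (c n : ℕ) → 4 ≤ c → 3 ≤ n → (T : Graph n) → IsTree T →
    MinNonLeafDegAtLeast T c →
    (B : Subset n) → IsTwoTotalLimitedPacking T B →
    (c ∸ 1) * ∣ B ∣ + (c ∸ 1) * (c ∸ 4) ≤ (c ∸ 2) * n
mainTheorem5 c n 4≤c 3≤n T (connected , acyclic) δ′≥c B packing =
  packing-arithmetic 4≤c 1≤s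
    (packing≤1+2*internal T connected B packing 1≤s)
    (card-internal-bound T acyclic (≤-trans (s≤s z≤n) 4≤c) δ′≥c (≤-trans (s≤s z≤n) 3≤n))
  where
  1≤s : 1 ≤ card (internal T)
  1≤s = card-internal-pos T connected 3≤n
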